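{- Let $P$ be an augmented program. If $M$ is a min-answer set of $P$, then $M$ is a minimal answer set of $P$, i.e. no answer set of $P$ is a proper subset of $M$.
   Context: A nested formula is built from atoms, $\bot,\top$ using $\land,\lor,\neg$; an augmented program is a finite set of clauses $H\leftarrow B$ ($H\leftarrow B$ meaning "$B$ implies $H$") with $H,B$ nested formulas. Answer sets: basic formulas are built from atoms, $\bot,\top$ with $\land,\lor$. For a set of atoms $X$: $X\models a$ iff $a\in X$, $X\models\top$, $X\not\models\bot$, $X\models F\land G$ iff both, $X\models F\lor G$ iff either. $X$ is closed under a basic program $Q$ if for each $H\leftarrow B\in Q$, $X\models B$ implies $X\models H$; $X$ is an answer set of basic $Q$ if $\subseteq$-minimal among sets closed under $Q$. Reduct: $F^X=F$ for atoms, $\bot,\top$; $(F\land G)^X=F^X\land G^X$; $(F\lor G)^X=F^X\lor G^X$; $(\neg F)^X=\bot$ if $X\models F^X$, else $\top$; $(H\leftarrow B)^X=H^X\leftarrow B^X$; $P^X=\{C^X:C\in P\}$. $X$ is an answer set of augmented $P$ iff $X$ is an answer set of $P^X$. A set of atoms $M$ is a model of $P$ if the classical interpretation making exactly the atoms of $M$ true satisfies every clause of $P$ (with $\neg F$ read as classical negation); a minimal model if no proper subset is a model. A min-answer set of $P$ is a set that is both an answer set and a minimal model of $P$. -}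

module Defs where

open import Data.Nat using (ℕ)
open import Data.Bool using (Bool; true; false; _∧_; _∨_; not)
open import Data.List using (List)
open import Data.List.Membership.Propositional using (_∈_)
open import Data.Product using (_×_; ∃)
open import Relation.Binary.PropositionalEquality using (_≡_)
open import Relation.Nullary using (¬_)

Atom : Set
Atom = ℕ

data Formula : Set where
  atom : Atom → Formula
  ⊥f ⊤f : Formula
  _∧f_ _∨f_ : Formula → Formula → Formula
  ¬f_ : Formula → Formula

record Clause : Set where
  constructor _⟵_
  field
    head : Formula
    body : Formula

Program : Set
Program = List Clause

AtomSet : Set
AtomSet = Atom → Bool

_⊆_ : AtomSet → AtomSet → Set
X ⊆ Y = ∀ a → X a ≡ true → Y a ≡ true

_⊂_ : AtomSet → AtomSet → Set
X ⊂ Y = X ⊆ Y × ∃ λ a → (Y a ≡ true × X a ≡ false)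

-- Classical truth value of a formula under the interpretation X
-- (¬ read as classical negation). On basic formulas this is
-- exactly the relation X ⊨ F of the paper.
eval : AtomSet → Formula → Bool
eval X (atom a) = X a
eval X ⊥f = false
eval X ⊤f = true
eval X (F ∧f G) = eval X F ∧ eval X G
eval X (F ∨f G) = eval X F ∨ eval X G
eval X (¬f F) = not (eval X F)

reduct : AtomSet → Formula → Formula
reduct X (atom a) = atom a
reduct X ⊥f = ⊥f
reduct X ⊤f = ⊤f
reduct X (F ∧f G) = reduct X F ∧f reduct X G
reduct X (F ∨f G) = reduct X F ∨f reduct X G
reduct X (¬f F) with eval X (reduct X F)
... | true = ⊥f
... | false = ⊤f

reductClause : AtomSet → Clause → Clause
reductClause X (H ⟵ B) = reduct X H ⟵ reduct X B

SatClause : AtomSet → Clause → Set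
SatClause X (H ⟵ B) = eval X B ≡ true → eval X H ≡ true

ClosedUnderReduct : AtomSet → Program → AtomSet → Set
ClosedUnderReduct X P Y = ∀ C → C ∈ P → SatClause Y (reductClause X C)

AnswerSet : Program → AtomSet → Set
AnswerSet P X = ClosedUnderReduct X P X × (∀ Y → ClosedUnderReduct X P Y → Y ⊆ X → X ⊆ Y)

Model : Program → AtomSet → Set
Model P M = ∀ C → C ∈ P → SatClause M C

MinimalModel : Program → AtomSet → Set
MinimalModel P M = Model P M × (∀ N → N ⊂ M → ¬ Model P N)

MinAnswerSet : Program → AtomSet → Set
MinAnswerSet P M = AnswerSet P M × MinimalModel P M

{-# OPTIONS --safe #-}
module Submission where

open import Defs
open import Relation.Nullary using (¬_)
open import Data.Bool using (true; false; _∧_; _∨_; not)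
open import Data.Product using (_,_)
open import Relation.Binary.PropositionalEquality using (_≡_; refl; cong; cong₂; trans; module ≡-Reasoning)

-- Evaluating the reduct F^X in X gives the classical value of F in X, so a set
-- closed under its own reduct is a classical model of P. An answer set X ⊂ M
-- would therefore be a model strictly below the minimal model M.

eval-reduct : ∀ X F → eval X (reduct X F) ≡ eval X F
eval-reduct X (atom a) = refl
eval-reduct X ⊥f = refl
eval-reduct X ⊤f = refl
eval-reduct X (F ∧f G) = cong₂ _∧_ (eval-reduct X F) (eval-reduct X G)
eval-reduct X (F ∨f G) = cong₂ _∨_ (eval-reduct X F) (eval-reduct X G)
eval-reduct X (¬f F) with eval X (reduct X F) | eval-reduct X F
... | true  | ih = cong not ih
... | false | ih = cong not ih

satClause-reduct : ∀ X C → SatClause X (reductClause X C) → SatClause X C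
satClause-reduct X (H ⟵ B) sat XB = begin
  eval X H            ≡⟨ eval-reduct X H ⟨
  eval X (reduct X H) ≡⟨ sat (trans (eval-reduct X B) XB) ⟩
  true                ∎
  where open ≡-Reasoning

answerSet⇒model : ∀ P X → AnswerSet P X → Model P X
answerSet⇒model P X (closed , _) C C∈P = satClause-reduct X C (closed C C∈P)

proposition5p3 : (P : Program) (M : AtomSet) → MinAnswerSet P M →
    (X : AtomSet) → AnswerSet P X → ¬ (X ⊂ M)
proposition5p3 P M (_ , _ , minimal) X answerSet X⊂M =
  minimal X X⊂M (answerSet⇒model P X answerSet)
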